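{- Let $d\ge 11$ be a prime and let $\mathscr{L}$ be the arrangement in $\mathbb{F}_d^2$ consisting of the $d+1$ lines $L_a:\ ax-(a+1)y-p(a)=0$ ($a\in\mathbb{F}_d$) and $L_\infty:\ x-y=0$. Let $\Gamma=\{\mathrm{Id},\iota,\theta,\theta^2,\kappa,\lambda\}\subset GL_2(\mathbb{F}_d)$ with $\iota(x,y)=(y,x)$, $\theta(x,y)=(y-x,-x)$, $\theta^2(x,y)=(-y,x-y)$, $\kappa(x,y)=(x-y,-y)$, $\lambda(x,y)=(-x,y-x)$. Let $a\in\mathbb{F}_d$ be such that the orbit $\{\gamma(L_a):\gamma\in\Gamma\}$ consists of six distinct lines (a "6-cycle"), and assume that none of these six lines passes through $(0,0)$. Then the six points $L_a\cap\theta(L_a)$, $L_a\cap\theta^2(L_a)$, $\theta(L_a)\cap\theta^2(L_a)$, $\iota(L_a)\cap\kappa(L_a)$, $\iota(L_a)\cap\lambda(L_a)$, $\kappa(L_a)\cap\lambda(L_a)$ (the intersection points of pairs of lines of this 6-cycle other than the nine pairs $\{\gamma(L_a),\gamma\circ\sigma(L_a)\}$ with $\sigma\in\{\iota,\kappa,\lambda\}$, whose intersections lie on $L_0\cup L_{ -1}\cup L_\infty$) are pairwise distinct.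
   Context: $p$ is the polynomial over $\mathbb{F}_d$ given by $p(x)=\frac{(x+1)^d-x^d-1}{d}$, i.e. the integer-coefficient polynomial $\sum_{k=1}^{d-1}\frac1d\binom dk x^k$ reduced modulo $d$. $\Gamma$ is the group generated by $\iota$ and $\theta$; it has the six listed elements, with $\kappa=\theta\circ\iota$, $\lambda=\iota\circ\theta$. For $\gamma\in GL_2(\mathbb{F}_d)$ and a line $L$, $\gamma(L)$ is the image line. Known facts (Pickett–Vinatier): for $d\ge5$, $\Gamma$ permutes the lines of $\mathscr{L}$; the $d+1$ lines of $\mathscr{L}$ have pairwise distinct directions, so any two distinct lines of $\mathscr{L}$ meet in exactly one point. The fixed-point sets of $\kappa,\lambda,\iota$ are respectively $L_0$, $L_{ -1}$, $L_\infty$. -}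

module Defs where

open import Data.Nat using (ℕ; zero; suc; _+_; _*_; _∸_; _^_; NonZero)
open import Data.Nat.DivMod using (_mod_; _/_)
open import Data.Nat.Combinatorics using (_C_)
open import Data.Fin using (Fin; toℕ; #_)
import Data.Fin as Fin
open import Data.Product using (_×_; _,_; ∃)
open import Relation.Binary.PropositionalEquality using (_≡_)
open import Relation.Nullary using (¬_)

F : ℕ → Set
F d = Fin d

module _ (d : ℕ) .{{_ : NonZero d}} where

  ι : ℕ → F d
  ι n = n mod d

  _⊕_ : F d → F d → F d
  a ⊕ b = ι (toℕ a + toℕ b)

  _⊗_ : F d → F d → F d
  a ⊗ b = ι (toℕ a * toℕ b)

  ⊖_ : F d → F d
  ⊖ a = ι (d ∸ toℕ a)

  _⊝_ : F d → F d → F d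
  a ⊝ b = a ⊕ (⊖ b)

  𝟘 𝟙 : F d
  𝟘 = ι 0
  𝟙 = ι 1

  -- p(a) = Σ_{k=1}^{d-1} (1/d)·binom(d,k)·a^k reduced mod d
  -- (the integer polynomial ((x+1)^d - x^d - 1)/d reduced modulo d).
  psum : ℕ → ℕ → ℕ
  psum a zero = 0
  psum a (suc m) = psum a m + ((d C suc m) / d) * a ^ suc m

  p : F d → F d
  p a = ι (psum (toℕ a) (d ∸ 1))

  Pt : Set
  Pt = F d × F d

  origin : Pt
  origin = (𝟘 , 𝟘)

  PtSet : Set₁
  PtSet = Pt → Set

  L : F d → PtSet
  L a (x , y) = (((a ⊗ x) ⊝ ((a ⊕ 𝟙) ⊗ y)) ⊝ p a) ≡ 𝟘

  idΓ iotaΓ thetaΓ theta2Γ kappaΓ lambdaΓ : Pt → Pt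
  idΓ v = v
  iotaΓ (x , y) = (y , x)
  thetaΓ (x , y) = (y ⊝ x , ⊖ x)
  theta2Γ (x , y) = (⊖ y , x ⊝ y)
  kappaΓ (x , y) = (x ⊝ y , ⊖ y)
  lambdaΓ (x , y) = (⊖ x , y ⊝ x)

image : {A : Set} → (A → A) → (A → Set) → (A → Set)
image γ S v = ∃ λ w → S w × γ w ≡ v

SameSet : {A : Set} → (A → Set) → (A → Set) → Set
SameSet S T = ∀ v → (S v → T v) × (T v → S v)

DistinctSets : {A : Set} → (A → Set) → (A → Set) → Set
DistinctSets S T = ¬ SameSet S T

module _ (d : ℕ) .{{_ : NonZero d}} where

  orbit : F d → Fin 6 → PtSet d
  orbit a Fin.zero = image (idΓ d) (L d a)
  orbit a (Fin.suc Fin.zero) = image (iotaΓ d) (L d a)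
  orbit a (Fin.suc (Fin.suc Fin.zero)) = image (thetaΓ d) (L d a)
  orbit a (Fin.suc (Fin.suc (Fin.suc Fin.zero))) = image (theta2Γ d) (L d a)
  orbit a (Fin.suc (Fin.suc (Fin.suc (Fin.suc Fin.zero)))) = image (kappaΓ d) (L d a)
  orbit a (Fin.suc (Fin.suc (Fin.suc (Fin.suc (Fin.suc Fin.zero))))) = image (lambdaΓ d) (L d a)

  pairIdx : Fin 6 → Fin 6 × Fin 6
  pairIdx Fin.zero = (# 0 , # 2)
  pairIdx (Fin.suc Fin.zero) = (# 0 , # 3)
  pairIdx (Fin.suc (Fin.suc Fin.zero)) = (# 2 , # 3)
  pairIdx (Fin.suc (Fin.suc (Fin.suc Fin.zero))) = (# 1 , # 4)
  pairIdx (Fin.suc (Fin.suc (Fin.suc (Fin.suc Fin.zero)))) = (# 1 , # 5)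
  pairIdx (Fin.suc (Fin.suc (Fin.suc (Fin.suc (Fin.suc Fin.zero))))) = (# 4 , # 5)

  OnPair : F d → Fin 6 → Pt d → Set
  OnPair a j P = orbit a (proj₁ (pairIdx j)) P × orbit a (proj₂ (pairIdx j)) P
    where open import Data.Product using (proj₁; proj₂)

module Submission where

-- Everything is transported from F_d to the integers modulo d.  Writing A and C
-- for the residues of a and p(a), the six lines of the orbit are α_i x + β_i y ≡ C
-- with coefficients α_i, β_i ∈ {A, -(A+1), 1} (orbit-equation).  Cramer's rule
-- gives Dp·(x, y) ≡ C·(ξ_j, η_j) for the j-th point, where Dp = A² + A + 1 and
-- ξ_j, η_j are linear in A (intersection); no division by Dp is needed.  If two
-- points coincide, cancelling C (nonzero, as L_a misses the origin; d prime)
-- gives ξ_j ≡ ξ_k and η_j ≡ η_k, and a linear combination of these yields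
-- 3 ≡ 0, A ≡ 1, A ≡ -2 or 2A + 1 ≡ 0 (forced-degeneracy).  The last three make
-- two lines of the orbit have congruent coefficients, hence coincide (same-line),
-- contradicting the 6-cycle hypothesis; 3 ≡ 0 contradicts d ≥ 11.

open import Defs
open import Data.Nat using (ℕ; _≤_; NonZero)
open import Data.Nat.Primality using (Prime)
open import Data.Fin using (Fin)
open import Relation.Binary.PropositionalEquality using (_≡_; _≢_)
open import Relation.Nullary using (¬_)

open import Data.Nat using (zero; suc; _∸_; s≤s) renaming (_<_ to _<ℕ_)
import Data.Nat as ℕ using (_+_; _*_)
import Data.Nat.Properties as ℕₚ
open import Data.Nat.Divisibility using (∣⇒≤) renaming (_∣_ to _∣ℕ_)
open import Data.Nat.DivMod using (_%_; _/_; m≡m%n+[m/n]*n; m%n<n)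
open import Data.Nat.Primality using (euclidsLemma)
open import Data.Integer using (ℤ; +_; -_; _+_; _-_; _*_; ∣_∣)
open import Data.Integer.Properties
  using (pos-+; pos-*; abs-*; ⊖-≥; m-n≡m⊖n; +-injective; ∣m⊝n∣≤m⊔n; ∣i∣≡0⇒i≡0;
         i-j≡0⇒i≡j; +-identityʳ; +-inverseʳ; neg-involutive)
open import Data.Integer.Divisibility.Signed
  using (_∣_; divides; ∣m∣n⇒∣m+n; ∣n⇒∣m*n; ∣⇒∣ᵤ; ∣ᵤ⇒∣)
open import Data.Integer.Tactic.RingSolver using (solve-∀)
open import Data.Fin using (toℕ; _<_) renaming (zero to 0F; suc to sucF)
open import Data.Fin.Properties using (toℕ-injective; toℕ<n; toℕ-fromℕ<; <-cmp)
open import Data.Product using (_×_; _,_; proj₁; proj₂; swap)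
open import Data.Sum using ([_,_]′)
open import Function using (id; _∘_; _⇔_; mk⇔; Equivalence)
open import Function.Properties.Equivalence using () renaming (trans to ⇔-trans)
open import Relation.Binary.Definitions using (tri<; tri≈; tri>)
open import Relation.Binary.PropositionalEquality
  using (refl; sym; trans; cong; cong₂; subst; module ≡-Reasoning)
open import Relation.Nullary using (contradiction)

open Equivalence using (to; from)

multiple-below : ∀ {d n} → n <ℕ d → d ∣ℕ n → n ≡ 0
multiple-below {n = zero}  _   _   = refl
multiple-below {n = suc n} n<d d∣n = contradiction (∣⇒≤ d∣n) (ℕₚ.<⇒≱ n<d)

image⇔preimage : {A : Set} {S : A → Set} (γ γ⁻¹ : A → A) →
                 (∀ w → γ⁻¹ (γ w) ≡ w) → (∀ v → γ (γ⁻¹ v) ≡ v) →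
                 ∀ v → image γ S v ⇔ S (γ⁻¹ v)
image⇔preimage {S = S} γ γ⁻¹ left right v = mk⇔
  (λ { (w , w∈S , γw≡v) → subst S (trans (sym (left w)) (cong γ⁻¹ γw≡v)) w∈S })
  (λ γ⁻¹v∈S → γ⁻¹ v , γ⁻¹v∈S , right v)

-- Congruence of integers modulo d.  Its algebraic properties are all instances
-- of ≋-combine: d divides every integer combination of multiples of d.
module Congruence (d : ℕ) where

  -- x ≋ y : d divides x - y  (a record, so that x and y can be inferred)
  infix 4 _≋_
  record _≋_ (x y : ℤ) : Set where
    constructor mod-d
    field divides-difference : + d ∣ (x - y)

  ≋-combine : ∀ s t {x x′ y y′ k k′} → s * (x - x′) + t * (y - y′) ≡ k - k′ →
              x ≋ x′ → y ≋ y′ → k ≋ k′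
  ≋-combine s t eq (mod-d d∣x-x′) (mod-d d∣y-y′) =
    mod-d (subst (+ d ∣_) eq (∣m∣n⇒∣m+n (∣n⇒∣m*n s d∣x-x′) (∣n⇒∣m*n t d∣y-y′)))

  ≋-refl : ∀ {x} → x ≋ x
  ≋-refl {x} = mod-d (divides (+ 0) (+-inverseʳ x))

  ≋-reflexive : ∀ {x y} → x ≡ y → x ≋ y
  ≋-reflexive refl = ≋-refl

  ≋-sym : ∀ {x y} → x ≋ y → y ≋ x
  ≋-sym {x} {y} x≋y = ≋-combine (- + 1) (+ 0) (identity x y) x≋y x≋y
    where
    identity : ∀ x y → - + 1 * (x - y) + + 0 * (x - y) ≡ y - x
    identity = solve-∀

  ≋-trans : ∀ {x y z} → x ≋ y → y ≋ z → x ≋ z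
  ≋-trans {x} {y} {z} = ≋-combine (+ 1) (+ 1) (identity x y z)
    where
    identity : ∀ x y z → + 1 * (x - y) + + 1 * (y - z) ≡ x - z
    identity = solve-∀

  ≋-+-cong : ∀ {x x′ y y′} → x ≋ x′ → y ≋ y′ → x + y ≋ x′ + y′
  ≋-+-cong {x} {x′} {y} {y′} = ≋-combine (+ 1) (+ 1) (identity x x′ y y′)
    where
    identity : ∀ x x′ y y′ → + 1 * (x - x′) + + 1 * (y - y′) ≡ (x + y) - (x′ + y′)
    identity = solve-∀

  ≋-*-cong : ∀ {x x′ y y′} → x ≋ x′ → y ≋ y′ → x * y ≋ x′ * y′
  ≋-*-cong {x} {x′} {y} {y′} = ≋-combine y x′ (identity x x′ y y′)
    where
    identity : ∀ x x′ y y′ → y * (x - x′) + x′ * (y - y′) ≡ x * y - x′ * y′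
    identity = solve-∀

  ≋-neg-cong : ∀ {x x′} → x ≋ x′ → - x ≋ - x′
  ≋-neg-cong {x} {x′} x≋x′ = ≋-combine (- + 1) (+ 0) (identity x x′) x≋x′ x≋x′
    where
    identity : ∀ x x′ → - + 1 * (x - x′) + + 0 * (x - x′) ≡ - x - - x′
    identity = solve-∀

  ≋-difference : ∀ {x c z} → z ≋ + 0 → (x - c ≋ z) ⇔ (x ≋ c)
  ≋-difference {x} {c} {z} z≋0 = mk⇔
    (λ h → ≋-combine (+ 1) (+ 1) (to-identity x c z) h z≋0)
    (λ h → ≋-combine (+ 1) (- + 1) (from-identity x c z) h z≋0)
    where
    to-identity : ∀ x c z → + 1 * ((x - c) - z) + + 1 * (z - + 0) ≡ x - c
    to-identity = solve-∀
    from-identity : ∀ x c z → + 1 * (x - c) + - + 1 * (z - + 0) ≡ (x - c) - z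
    from-identity = solve-∀

  ≋-rewriteˡ : ∀ {x x′ y} → x ≡ x′ → (x ≋ y) ⇔ (x′ ≋ y)
  ≋-rewriteˡ refl = mk⇔ id id

  ≉0-below : ∀ n → suc n <ℕ d → ¬ (+ suc n ≋ + 0)
  ≉0-below n n<d (mod-d d∣n) with multiple-below n<d
    (subst (d ∣ℕ_) (ℕₚ.+-identityʳ (suc n)) (∣⇒∣ᵤ d∣n))
  ... | ()

  cramer : ∀ α₁ β₁ α₂ β₂ {c x y} → α₁ * x + β₁ * y ≋ c → α₂ * x + β₂ * y ≋ c →
           (α₁ * β₂ - α₂ * β₁) * x ≋ (β₂ - β₁) * c ×
           (α₁ * β₂ - α₂ * β₁) * y ≋ (α₁ - α₂) * c
  cramer α₁ β₁ α₂ β₂ {c} {x} {y} e₁ e₂ =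
    ≋-combine β₂ (- β₁) (x-identity α₁ β₁ α₂ β₂ c x y) e₁ e₂ ,
    ≋-combine (- α₂) α₁ (y-identity α₁ β₁ α₂ β₂ c x y) e₁ e₂
    where
    x-identity : ∀ α₁ β₁ α₂ β₂ c x y →
      β₂ * ((α₁ * x + β₁ * y) - c) + - β₁ * ((α₂ * x + β₂ * y) - c)
        ≡ (α₁ * β₂ - α₂ * β₁) * x - (β₂ - β₁) * c
    x-identity = solve-∀
    y-identity : ∀ α₁ β₁ α₂ β₂ c x y →
      - α₂ * ((α₁ * x + β₁ * y) - c) + α₁ * ((α₂ * x + β₂ * y) - c)
        ≡ (α₁ * β₂ - α₂ * β₁) * y - (α₁ - α₂) * c
    y-identity = solve-∀

  ≋-cancelʳ : Prime d → ∀ {c x y} → ¬ (c ≋ + 0) → x * c ≋ y * c → x ≋ y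
  ≋-cancelʳ d-prime {c} {x} {y} c≉0 (mod-d d∣xc-yc) =
    [ mod-d ∘ ∣ᵤ⇒∣ , (λ d∣c → contradiction (c≋0 d∣c) c≉0) ]′
      (euclidsLemma ∣ x - y ∣ ∣ c ∣ d-prime d∣product)
    where
    factor : ∀ x y c → x * c - y * c ≡ (x - y) * c
    factor = solve-∀
    d∣product : d ∣ℕ ∣ x - y ∣ ℕ.* ∣ c ∣
    d∣product = subst (d ∣ℕ_) (abs-* (x - y) c)
                      (∣⇒∣ᵤ (subst (+ d ∣_) (factor x y c) d∣xc-yc))
    c≋0 : d ∣ℕ ∣ c ∣ → c ≋ + 0
    c≋0 d∣c = mod-d (subst (+ d ∣_) (sym (+-identityʳ c)) (∣ᵤ⇒∣ d∣c))

module Residues (d : ℕ) .{{_ : NonZero d}} where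
  open Congruence d

  ⟦_⟧ : F d → ℤ
  ⟦ u ⟧ = + toℕ u

  residue : ∀ n → ⟦ ι d n ⟧ ≋ + n
  residue n = mod-d (divides (- + (n / d)) (begin
    + toℕ (ι d n) - + n
      ≡⟨ cong₂ (λ r m → + r - + m) (toℕ-fromℕ< (m%n<n n d)) (m≡m%n+[m/n]*n n d) ⟩
    + (n % d) - + (n % d ℕ.+ n / d ℕ.* d)
      ≡⟨ cong (λ m → + (n % d) - m)
              (trans (pos-+ (n % d) _) (cong (λ m → + (n % d) + m) (pos-* (n / d) d))) ⟩
    + (n % d) - (+ (n % d) + + (n / d) * + d)
      ≡⟨ drop-remainder (+ (n % d)) (+ (n / d)) (+ d) ⟩
    - + (n / d) * + d ∎))
    where
    open ≡-Reasoning
    drop-remainder : ∀ r q d → r - (r + q * d) ≡ - q * d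
    drop-remainder = solve-∀

  -- Distinct residues are incongruent, as their difference is smaller than d.
  residue-injective : ∀ {u v} → ⟦ u ⟧ ≋ ⟦ v ⟧ → u ≡ v
  residue-injective {u} {v} (mod-d d∣u-v) =
    toℕ-injective (+-injective (i-j≡0⇒i≡j _ _ (∣i∣≡0⇒i≡0 difference≡0)))
    where
    bound : ∣ ⟦ u ⟧ - ⟦ v ⟧ ∣ <ℕ d
    bound rewrite m-n≡m⊖n (toℕ u) (toℕ v) =
      ℕₚ.≤-<-trans (∣m⊝n∣≤m⊔n (toℕ u) (toℕ v)) (ℕₚ.⊔-lub (toℕ<n u) (toℕ<n v))
    difference≡0 : ∣ ⟦ u ⟧ - ⟦ v ⟧ ∣ ≡ 0
    difference≡0 = multiple-below bound (∣⇒∣ᵤ d∣u-v)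

  ⊕-residue : ∀ u v → ⟦ _⊕_ d u v ⟧ ≋ ⟦ u ⟧ + ⟦ v ⟧
  ⊕-residue u v = ≋-trans (residue _) (≋-reflexive (pos-+ (toℕ u) (toℕ v)))

  ⊗-residue : ∀ u v → ⟦ _⊗_ d u v ⟧ ≋ ⟦ u ⟧ * ⟦ v ⟧
  ⊗-residue u v = ≋-trans (residue _) (≋-reflexive (pos-* (toℕ u) (toℕ v)))

  ⊖-residue : ∀ u → ⟦ ⊖_ d u ⟧ ≋ - ⟦ u ⟧
  ⊖-residue u = ≋-trans (residue _) (≋-trans (≋-reflexive complement) d≋0)
    where
    complement : + (d ∸ toℕ u) ≡ + d - ⟦ u ⟧
    complement = sym (trans (m-n≡m⊖n d (toℕ u)) (⊖-≥ (ℕₚ.<⇒≤ (toℕ<n u))))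
    drop-d : ∀ d x → (d - x) - - x ≡ + 1 * d
    drop-d = solve-∀
    d≋0 : + d - ⟦ u ⟧ ≋ - ⟦ u ⟧
    d≋0 = mod-d (divides (+ 1) (drop-d (+ d) ⟦ u ⟧))

  data Expr : Set where
    var     : F d → Expr
    add mul : Expr → Expr → Expr
    neg     : Expr → Expr
    one     : Expr

  evalF : Expr → F d
  evalF (var u)   = u
  evalF (add e f) = _⊕_ d (evalF e) (evalF f)
  evalF (mul e f) = _⊗_ d (evalF e) (evalF f)
  evalF (neg e)   = ⊖_ d (evalF e)
  evalF one       = 𝟙 d

  evalℤ : Expr → ℤ
  evalℤ (var u)   = ⟦ u ⟧
  evalℤ (add e f) = evalℤ e + evalℤ f
  evalℤ (mul e f) = evalℤ e * evalℤ f
  evalℤ (neg e)   = - evalℤ e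
  evalℤ one       = + 1

  eval-sound : ∀ e → ⟦ evalF e ⟧ ≋ evalℤ e
  eval-sound (var u)   = ≋-refl
  eval-sound (add e f) =
    ≋-trans (⊕-residue (evalF e) (evalF f)) (≋-+-cong (eval-sound e) (eval-sound f))
  eval-sound (mul e f) =
    ≋-trans (⊗-residue (evalF e) (evalF f)) (≋-*-cong (eval-sound e) (eval-sound f))
  eval-sound (neg e)   = ≋-trans (⊖-residue (evalF e)) (≋-neg-cong (eval-sound e))
  eval-sound one       = residue 1

  evalF-≡ : ∀ e u → (evalF e ≡ u) ⇔ (evalℤ e ≋ ⟦ u ⟧)
  evalF-≡ e u = mk⇔
    (λ { refl → ≋-sym (eval-sound e) })
    (λ e≋u → residue-injective (≋-trans (eval-sound e) e≋u))

  evaluates-to : ∀ e u → evalℤ e ≡ ⟦ u ⟧ → evalF e ≡ u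
  evaluates-to e u = from (evalF-≡ e u) ∘ ≋-reflexive

  ⊖⊖ : ∀ v → ⊖_ d (⊖_ d v) ≡ v
  ⊖⊖ v = evaluates-to (neg (neg (var v))) v (neg-involutive ⟦ v ⟧)

  ⊝⊖ : ∀ u v → _⊝_ d (_⊝_ d u v) (⊖_ d v) ≡ u
  ⊝⊖ u v = evaluates-to (add (add (var u) (neg (var v))) (neg (neg (var v)))) u
                        (identity ⟦ u ⟧ ⟦ v ⟧)
    where
    identity : ∀ u v → u - v - - v ≡ u
    identity = solve-∀

pattern 1F = sucF 0F
pattern 2F = sucF 1F
pattern 3F = sucF 2F
pattern 4F = sucF 3F
pattern 5F = sucF 4F

module Arrangement (d : ℕ) .{{_ : NonZero d}} (a : F d) where
  open Congruence d
  open Residues d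

  A C : ℤ
  A = ⟦ a ⟧
  C = ⟦ p d a ⟧

  -- The defining equation of L_a, at a point whose coordinates are terms;
  -- L d a (evalF g₁ , evalF g₂) unfolds to "evalF of the term below ≡ 𝟘".
  on-Lₐ : ∀ g₁ g₂ →
          L d a (evalF g₁ , evalF g₂) ⇔ (A * evalℤ g₁ - (A + + 1) * evalℤ g₂ ≋ C)
  on-Lₐ g₁ g₂ = ⇔-trans
    (evalF-≡ (add (add (mul (var a) g₁) (neg (mul (add (var a) one) g₂))) (neg (var (p d a))))
             (𝟘 d))
    (≋-difference (residue 0))

  image-of-Lₐ : ∀ (γ γ⁻¹ : Pt d → Pt d) →
                (∀ w → γ⁻¹ (γ w) ≡ w) → (∀ v → γ (γ⁻¹ v) ≡ v) →
                ∀ g₁ g₂ α′ β′ {x y} → γ⁻¹ (x , y) ≡ (evalF g₁ , evalF g₂) →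
                A * evalℤ g₁ - (A + + 1) * evalℤ g₂ ≡ α′ * ⟦ x ⟧ + β′ * ⟦ y ⟧ →
                image γ (L d a) (x , y) ⇔ (α′ * ⟦ x ⟧ + β′ * ⟦ y ⟧ ≋ C)
  image-of-Lₐ γ γ⁻¹ left right g₁ g₂ α′ β′ {x} {y} γ⁻¹xy substituted = ⇔-trans
    (subst (λ w → image γ (L d a) (x , y) ⇔ L d a w) γ⁻¹xy
           (image⇔preimage γ γ⁻¹ left right (x , y)))
    (⇔-trans (on-Lₐ g₁ g₂) (≋-rewriteˡ substituted))

  θ∘θ² : ∀ v → thetaΓ d (theta2Γ d v) ≡ v
  θ∘θ² (x , y) = cong₂ _,_ (⊝⊖ x y) (⊖⊖ y)

  θ²∘θ : ∀ v → theta2Γ d (thetaΓ d v) ≡ v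
  θ²∘θ (x , y) = cong₂ _,_ (⊖⊖ x) (⊝⊖ y x)

  κ∘κ : ∀ v → kappaΓ d (kappaΓ d v) ≡ v
  κ∘κ (x , y) = cong₂ _,_ (⊝⊖ x y) (⊖⊖ y)

  λ∘λ : ∀ v → lambdaΓ d (lambdaΓ d v) ≡ v
  λ∘λ (x , y) = cong₂ _,_ (⊖⊖ x) (⊝⊖ y x)

  α β : Fin 6 → ℤ
  α 0F = A
  α 1F = - (A + + 1)
  α 2F = - (A + + 1)
  α 3F = + 1
  α 4F = A
  α 5F = + 1
  β 0F = - (A + + 1)
  β 1F = A
  β 2F = + 1
  β 3F = A
  β 4F = + 1
  β 5F = - (A + + 1)

  orbit-equation : ∀ i x y → orbit d a i (x , y) ⇔ (α i * ⟦ x ⟧ + β i * ⟦ y ⟧ ≋ C)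
  orbit-equation 0F x y =
    image-of-Lₐ (idΓ d) (idΓ d) (λ _ → refl) (λ _ → refl)
      (var x) (var y) (α 0F) (β 0F) refl (L-id A ⟦ x ⟧ ⟦ y ⟧)
    where
    L-id : ∀ A x y → A * x - (A + + 1) * y ≡ A * x + - (A + + 1) * y
    L-id = solve-∀
  orbit-equation 1F x y =
    image-of-Lₐ (iotaΓ d) (iotaΓ d) (λ _ → refl) (λ _ → refl)
      (var y) (var x) (α 1F) (β 1F) refl (L-ι A ⟦ x ⟧ ⟦ y ⟧)
    where
    L-ι : ∀ A x y → A * y - (A + + 1) * x ≡ - (A + + 1) * x + A * y
    L-ι = solve-∀
  orbit-equation 2F x y =
    image-of-Lₐ (thetaΓ d) (theta2Γ d) θ²∘θ θ∘θ²
      (neg (var y)) (add (var x) (neg (var y))) (α 2F) (β 2F) refl (L-θ A ⟦ x ⟧ ⟦ y ⟧)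
    where
    L-θ : ∀ A x y → A * - y - (A + + 1) * (x - y) ≡ - (A + + 1) * x + + 1 * y
    L-θ = solve-∀
  orbit-equation 3F x y =
    image-of-Lₐ (theta2Γ d) (thetaΓ d) θ∘θ² θ²∘θ
      (add (var y) (neg (var x))) (neg (var x)) (α 3F) (β 3F) refl (L-θ² A ⟦ x ⟧ ⟦ y ⟧)
    where
    L-θ² : ∀ A x y → A * (y - x) - (A + + 1) * - x ≡ + 1 * x + A * y
    L-θ² = solve-∀
  orbit-equation 4F x y =
    image-of-Lₐ (kappaΓ d) (kappaΓ d) κ∘κ κ∘κ
      (add (var x) (neg (var y))) (neg (var y)) (α 4F) (β 4F) refl (L-κ A ⟦ x ⟧ ⟦ y ⟧)
    where
    L-κ : ∀ A x y → A * (x - y) - (A + + 1) * - y ≡ A * x + + 1 * y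
    L-κ = solve-∀
  orbit-equation 5F x y =
    image-of-Lₐ (lambdaΓ d) (lambdaΓ d) λ∘λ λ∘λ
      (neg (var x)) (add (var y) (neg (var x))) (α 5F) (β 5F) refl (L-λ A ⟦ x ⟧ ⟦ y ⟧)
    where
    L-λ : ∀ A x y → A * - x - (A + + 1) * (y - x) ≡ + 1 * x + - (A + + 1) * y
    L-λ = solve-∀

  same-line : ∀ i j → α i ≋ α j → β i ≋ β j → SameSet (orbit d a i) (orbit d a j)
  same-line i j αᵢ≋αⱼ βᵢ≋βⱼ (x , y) =
    (λ on-i → from (orbit-equation j x y)
                   (≋-trans (≋-sym coefficients) (to (orbit-equation i x y) on-i))) ,
    (λ on-j → from (orbit-equation i x y)
                   (≋-trans coefficients (to (orbit-equation j x y) on-j)))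
    where
    coefficients : α i * ⟦ x ⟧ + β i * ⟦ y ⟧ ≋ α j * ⟦ x ⟧ + β j * ⟦ y ⟧
    coefficients = ≋-+-cong (≋-*-cong αᵢ≋αⱼ ≋-refl) (≋-*-cong βᵢ≋βⱼ ≋-refl)

  C≉0 : ¬ orbit d a 0F (origin d) → ¬ (C ≋ + 0)
  C≉0 origin∉Lₐ C≋0 =
    origin∉Lₐ (from (orbit-equation 0F (𝟘 d) (𝟘 d)) (≋-trans at-origin (≋-sym C≋0)))
    where
    vanishing : ∀ α β z → α * (z - + 0) + β * (z - + 0) ≡ (α * z + β * z) - + 0
    vanishing = solve-∀
    at-origin : α 0F * ⟦ 𝟘 d ⟧ + β 0F * ⟦ 𝟘 d ⟧ ≋ + 0
    at-origin = ≋-combine (α 0F) (β 0F) (vanishing (α 0F) (β 0F) ⟦ 𝟘 d ⟧)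
                          (residue 0) (residue 0)

  -- The j-th point lies on the lines `first j` and `second j` (the pair of the
  -- statement, possibly swapped), ordered so that their determinant is Dp.
  first second : Fin 6 → Fin 6
  first 0F = 2F
  first 1F = 0F
  first 2F = 3F
  first 3F = 4F
  first 4F = 1F
  first 5F = 5F
  second 0F = 0F
  second 1F = 3F
  second 2F = 2F
  second 3F = 1F
  second 4F = 5F
  second 5F = 4F

  on-oriented-pair : ∀ j {v} → OnPair d a j v →
                     orbit d a (first j) v × orbit d a (second j) v
  on-oriented-pair 0F = swap
  on-oriented-pair 1F = id
  on-oriented-pair 2F = swap
  on-oriented-pair 3F = swap
  on-oriented-pair 4F = id
  on-oriented-pair 5F = swap

  Dp : ℤ
  Dp = A * A + A + + 1

  determinant : ∀ j → α (first j) * β (second j) - α (second j) * β (first j) ≡ Dp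
  determinant 0F = det A
    where det : ∀ A → - (A + + 1) * - (A + + 1) - A * + 1 ≡ A * A + A + + 1
          det = solve-∀
  determinant 1F = det A
    where det : ∀ A → A * A - + 1 * - (A + + 1) ≡ A * A + A + + 1
          det = solve-∀
  determinant 2F = det A
    where det : ∀ A → + 1 * + 1 - - (A + + 1) * A ≡ A * A + A + + 1
          det = solve-∀
  determinant 3F = det A
    where det : ∀ A → A * A - - (A + + 1) * + 1 ≡ A * A + A + + 1
          det = solve-∀
  determinant 4F = det A
    where det : ∀ A → - (A + + 1) * - (A + + 1) - + 1 * A ≡ A * A + A + + 1
          det = solve-∀
  determinant 5F = det A
    where det : ∀ A → + 1 * + 1 - A * - (A + + 1) ≡ A * A + A + + 1
          det = solve-∀

  -- Normalised coordinates: by Cramer's rule the j-th point is (C/Dp)·(ξ j, η j).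
  ξ η : Fin 6 → ℤ
  ξ j = β (second j) - β (first j)
  η j = α (first j) - α (second j)

  intersection : ∀ j {x y} → OnPair d a j (x , y) →
                 Dp * ⟦ x ⟧ ≋ ξ j * C × Dp * ⟦ y ⟧ ≋ η j * C
  intersection j {x} {y} on-pair =
    subst (λ Δ → Δ * ⟦ x ⟧ ≋ ξ j * C) (determinant j) (proj₁ solution) ,
    subst (λ Δ → Δ * ⟦ y ⟧ ≋ η j * C) (determinant j) (proj₂ solution)
    where
    on-lines : orbit d a (first j) (x , y) × orbit d a (second j) (x , y)
    on-lines = on-oriented-pair j on-pair
    Δ : ℤ
    Δ = α (first j) * β (second j) - α (second j) * β (first j)
    solution : Δ * ⟦ x ⟧ ≋ ξ j * C × Δ * ⟦ y ⟧ ≋ η j * C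
    solution = cramer (α (first j)) (β (first j)) (α (second j)) (β (second j))
                      (to (orbit-equation (first j) x y) (proj₁ on-lines))
                      (to (orbit-equation (second j) x y) (proj₂ on-lines))

  -- Two of the points coincide only if their normalised coordinates agree:
  -- the common factor C cancels since d is prime.
  coincident-coordinates : Prime d → ¬ (C ≋ + 0) → ∀ j k {v} →
                           OnPair d a j v → OnPair d a k v → ξ j ≋ ξ k × η j ≋ η k
  coincident-coordinates d-prime C≉0 j k on-j on-k =
    cancel (proj₁ (intersection j on-j)) (proj₁ (intersection k on-k)) ,
    cancel (proj₂ (intersection j on-j)) (proj₂ (intersection k on-k))
    where
    cancel : ∀ {z u v} → Dp * z ≋ u * C → Dp * z ≋ v * C → u ≋ v
    cancel z≋u z≋v = ≋-cancelʳ d-prime C≉0 (≋-trans (≋-sym z≋u) z≋v)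

  -- The conditions that make two lines of the orbit coincide, and 3 ≡ 0.
  data Degenerate : Set where
    3≋0    : + 3 ≋ + 0 → Degenerate
    a≋1    : A ≋ + 1 → Degenerate
    a≋-2   : A ≋ - + 2 → Degenerate
    2a+1≋0 : A ≋ - (A + + 1) → Degenerate

  -- Ring identities certifying, for each pair j < k, that a linear combination
  -- of ξ j - ξ k and η j - η k equals a degenerate quantity (written k - k′ for
  -- the congruence k ≋ k′); the left-hand sides are ξ and η unfolded.
  certificate₀₁ : ∀ A → - + 1 * ((- (A + + 1) - + 1) - (A - - (A + + 1)))
                        + + 1 * ((- (A + + 1) - A) - (A - + 1)) ≡ + 3 - + 0
  certificate₀₁ = solve-∀
  certificate₀₂ : ∀ A → - + 1 * ((- (A + + 1) - + 1) - (+ 1 - A))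
                        + + 0 * ((- (A + + 1) - A) - (+ 1 - - (A + + 1))) ≡ + 3 - + 0
  certificate₀₂ = solve-∀
  certificate₀₃ : ∀ A → - + 1 * ((- (A + + 1) - + 1) - (A - + 1))
                        + + 0 * ((- (A + + 1) - A) - (A - - (A + + 1))) ≡ A - - (A + + 1)
  certificate₀₃ = solve-∀
  certificate₀₄ : ∀ A → + 1 * ((- (A + + 1) - + 1) - (- (A + + 1) - A))
                        + + 0 * ((- (A + + 1) - A) - (- (A + + 1) - + 1)) ≡ A - + 1
  certificate₀₄ = solve-∀
  certificate₀₅ : ∀ A → + 0 * ((- (A + + 1) - + 1) - (+ 1 - - (A + + 1)))
                        + - + 1 * ((- (A + + 1) - A) - (+ 1 - A)) ≡ A - - + 2
  certificate₀₅ = solve-∀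
  certificate₁₂ : ∀ A → + 0 * ((A - - (A + + 1)) - (+ 1 - A))
                        + - + 1 * ((A - + 1) - (+ 1 - - (A + + 1))) ≡ + 3 - + 0
  certificate₁₂ = solve-∀
  certificate₁₃ : ∀ A → + 1 * ((A - - (A + + 1)) - (A - + 1))
                        + + 0 * ((A - + 1) - (A - - (A + + 1))) ≡ A - - + 2
  certificate₁₃ = solve-∀
  certificate₁₄ : ∀ A → + 0 * ((A - - (A + + 1)) - (- (A + + 1) - A))
                        + + 1 * ((A - + 1) - (- (A + + 1) - + 1)) ≡ A - - (A + + 1)
  certificate₁₄ = solve-∀
  certificate₁₅ : ∀ A → + 1 * ((A - - (A + + 1)) - (+ 1 - - (A + + 1)))
                        + + 0 * ((A - + 1) - (+ 1 - A)) ≡ A - + 1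
  certificate₁₅ = solve-∀
  certificate₂₃ : ∀ A → + 0 * ((+ 1 - A) - (A - + 1))
                        + - + 1 * ((+ 1 - - (A + + 1)) - (A - - (A + + 1))) ≡ A - + 1
  certificate₂₃ = solve-∀
  certificate₂₄ : ∀ A → + 1 * ((+ 1 - A) - (- (A + + 1) - A))
                        + + 0 * ((+ 1 - - (A + + 1)) - (- (A + + 1) - + 1)) ≡ A - - + 2
  certificate₂₄ = solve-∀
  certificate₂₅ : ∀ A → - + 1 * ((+ 1 - A) - (+ 1 - - (A + + 1)))
                        + + 0 * ((+ 1 - - (A + + 1)) - (+ 1 - A)) ≡ A - - (A + + 1)
  certificate₂₅ = solve-∀
  certificate₃₄ : ∀ A → - + 1 * ((A - + 1) - (- (A + + 1) - A))
                        + + 1 * ((A - - (A + + 1)) - (- (A + + 1) - + 1)) ≡ + 3 - + 0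
  certificate₃₄ = solve-∀
  certificate₃₅ : ∀ A → - + 1 * ((A - + 1) - (+ 1 - - (A + + 1)))
                        + + 0 * ((A - - (A + + 1)) - (+ 1 - A)) ≡ + 3 - + 0
  certificate₃₅ = solve-∀
  certificate₄₅ : ∀ A → + 0 * ((- (A + + 1) - A) - (+ 1 - - (A + + 1)))
                        + - + 1 * ((- (A + + 1) - + 1) - (+ 1 - A)) ≡ + 3 - + 0
  certificate₄₅ = solve-∀

  forced-degeneracy : ∀ j k → j < k → ξ j ≋ ξ k → η j ≋ η k → Degenerate
  forced-degeneracy 0F 1F _ ξ≋ η≋ =
    3≋0 (≋-combine (- + 1) (+ 1) (certificate₀₁ A) ξ≋ η≋)
  forced-degeneracy 0F 2F _ ξ≋ η≋ =
    3≋0 (≋-combine (- + 1) (+ 0) (certificate₀₂ A) ξ≋ η≋)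
  forced-degeneracy 0F 3F _ ξ≋ η≋ =
    2a+1≋0 (≋-combine (- + 1) (+ 0) (certificate₀₃ A) ξ≋ η≋)
  forced-degeneracy 0F 4F _ ξ≋ η≋ =
    a≋1 (≋-combine (+ 1) (+ 0) (certificate₀₄ A) ξ≋ η≋)
  forced-degeneracy 0F 5F _ ξ≋ η≋ =
    a≋-2 (≋-combine (+ 0) (- + 1) (certificate₀₅ A) ξ≋ η≋)
  forced-degeneracy 1F 2F _ ξ≋ η≋ =
    3≋0 (≋-combine (+ 0) (- + 1) (certificate₁₂ A) ξ≋ η≋)
  forced-degeneracy 1F 3F _ ξ≋ η≋ =
    a≋-2 (≋-combine (+ 1) (+ 0) (certificate₁₃ A) ξ≋ η≋)
  forced-degeneracy 1F 4F _ ξ≋ η≋ =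
    2a+1≋0 (≋-combine (+ 0) (+ 1) (certificate₁₄ A) ξ≋ η≋)
  forced-degeneracy 1F 5F _ ξ≋ η≋ =
    a≋1 (≋-combine (+ 1) (+ 0) (certificate₁₅ A) ξ≋ η≋)
  forced-degeneracy 2F 3F _ ξ≋ η≋ =
    a≋1 (≋-combine (+ 0) (- + 1) (certificate₂₃ A) ξ≋ η≋)
  forced-degeneracy 2F 4F _ ξ≋ η≋ =
    a≋-2 (≋-combine (+ 1) (+ 0) (certificate₂₄ A) ξ≋ η≋)
  forced-degeneracy 2F 5F _ ξ≋ η≋ =
    2a+1≋0 (≋-combine (- + 1) (+ 0) (certificate₂₅ A) ξ≋ η≋)
  forced-degeneracy 3F 4F _ ξ≋ η≋ =
    3≋0 (≋-combine (- + 1) (+ 1) (certificate₃₄ A) ξ≋ η≋)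
  forced-degeneracy 3F 5F _ ξ≋ η≋ =
    3≋0 (≋-combine (- + 1) (+ 0) (certificate₃₅ A) ξ≋ η≋)
  forced-degeneracy 4F 5F _ ξ≋ η≋ =
    3≋0 (≋-combine (+ 0) (- + 1) (certificate₄₅ A) ξ≋ η≋)
  forced-degeneracy (sucF _) 1F (s≤s ())
  forced-degeneracy (sucF (sucF _)) 2F (s≤s (s≤s ()))
  forced-degeneracy (sucF (sucF (sucF _))) 3F (s≤s (s≤s (s≤s ())))
  forced-degeneracy (sucF (sucF (sucF (sucF _)))) 4F (s≤s (s≤s (s≤s (s≤s ()))))
  forced-degeneracy (sucF (sucF (sucF (sucF (sucF _))))) 5F (s≤s (s≤s (s≤s (s≤s (s≤s ())))))

  distinct-coordinates : ∀ j k → j ≢ k → ξ j ≋ ξ k → η j ≋ η k → Degenerate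
  distinct-coordinates j k j≢k ξ≋ η≋ with <-cmp j k
  ... | tri< j<k _ _ = forced-degeneracy j k j<k ξ≋ η≋
  ... | tri≈ _ j≡k _ = contradiction j≡k j≢k
  ... | tri> _ _ k<j = forced-degeneracy k j k<j (≋-sym ξ≋) (≋-sym η≋)

  -- In a 6-cycle no degenerate condition holds: each of the last three makes
  -- two lines of the orbit equal, and 3 ≢ 0 since 3 < d.
  non-degenerate : 3 <ℕ d → (∀ i j → i ≢ j → DistinctSets (orbit d a i) (orbit d a j)) →
                   ¬ Degenerate
  non-degenerate 3<d distinct (3≋0 three≋0)     = ≉0-below 2 3<d three≋0
  non-degenerate 3<d distinct (a≋1 A≋1)         =
    distinct 1F 2F (λ ()) (same-line 1F 2F ≋-refl A≋1)
  non-degenerate 3<d distinct (a≋-2 A≋-2)       =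
    distinct 0F 4F (λ ())
      (same-line 0F 4F ≋-refl (≋-neg-cong (≋-+-cong A≋-2 (≋-refl {+ 1}))))
  non-degenerate 3<d distinct (2a+1≋0 A≋-A-1)   =
    distinct 0F 1F (λ ()) (same-line 0F 1F A≋-A-1 (≋-sym A≋-A-1))

proposition3 : (d : ℕ) .{{_ : NonZero d}} → Prime d → 11 ≤ d →
    (a : F d) →
    (∀ (i j : Fin 6) → i ≢ j → DistinctSets (orbit d a i) (orbit d a j)) →
    (∀ (i : Fin 6) → ¬ orbit d a i (origin d)) →
    (P : Fin 6 → Pt d) →
    (∀ (j : Fin 6) → OnPair d a j (P j)) →
    ∀ (j k : Fin 6) → j ≢ k → P j ≢ P k
proposition3 d d-prime 11≤d a distinct off-origin P on-pair j k j≢k Pj≡Pk =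
  non-degenerate 3<d distinct
    (distinct-coordinates j k j≢k (proj₁ coordinates) (proj₂ coordinates))
  where
  open Congruence d
  open Arrangement d a
  3<d : 3 <ℕ d
  3<d = ℕₚ.≤-trans (ℕₚ.m≤m+n 4 7) 11≤d
  coordinates : ξ j ≋ ξ k × η j ≋ η k
  coordinates = coincident-coordinates d-prime (C≉0 (off-origin 0F)) j k
                  (on-pair j) (subst (OnPair d a k) (sym Pj≡Pk) (on-pair k))
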